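{- Let $\mathbb{M}=(V,\mathcal{C})$ be a simple binary matroid. Then the family of chordless circuits of $\mathbb{M}$ is the unique minimum-cardinality generator of $\mathcal{C}$.
   Context: A binary matroid is one representable over GF(2); simple means no loops and no parallel elements; $\mathcal{C}$ is the family of circuits. A circuit $C\in\mathcal{C}$ is chordless if there is no $C'\in\mathcal{C}$ with $|C'\setminus C|=1$ and $|C'|<|C|$. For $\mathcal{F}\subseteq 2^V$ and $\mathcal{G}\subseteq\mathcal{F}$, let $\langle\mathcal{G}\rangle^1_{\mathcal{F}}=\mathcal{G}\cup\{X\in\mathcal{F}: X=(X_1\cup X_2)\setminus\{v\}$ for distinct $X_1,X_2\in\mathcal{G}$ and $v\in X_1\cap X_2\}$, iterate this operator until it stabilizes, and call the final family $\langle\mathcal{G}\rangle_{\mathcal{F}}$; $\mathcal{G}$ is a generator of $\mathcal{F}$ if $\langle\mathcal{G}\rangle_{\mathcal{F}}=\mathcal{F}$. -}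

module Defs where

open import Data.Bool using (Bool; true; false; _∧_; _∨_; not; if_then_else_; _xor_; T)
open import Data.Nat using (ℕ; zero; suc; _≡ᵇ_; _<ᵇ_)
open import Data.Fin using (Fin)
open import Data.Fin.Subset using (Subset; _∪_; _─_; _-_; ∣_∣)
open import Data.Vec using (Vec; []; _∷_; lookup; replicate; zipWith)
open import Data.List using (List; []; _∷_; _++_; map)
open import Data.List.Base using (allFin)
open import Data.Product using (Σ; _×_)

-- Ground set V = Fin n; subsets of V are 'Subset n' (= Vec Bool n).
-- A family of subsets of V is a Boolean-valued function on Subset n
-- (an arbitrary element of 2^(2^V)).

Fam : ℕ → Set
Fam n = Subset n → Bool

subsets : (n : ℕ) → List (Subset n)
subsets zero    = [] ∷ []
subsets (suc n) = map (false ∷_) (subsets n) ++ map (true ∷_) (subsets n)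

allL : {A : Set} → (A → Bool) → List A → Bool
allL p []       = true
allL p (x ∷ xs) = p x ∧ allL p xs

anyL : {A : Set} → (A → Bool) → List A → Bool
anyL p []       = false
anyL p (x ∷ xs) = p x ∨ anyL p xs

_==ₛ_ : {n : ℕ} → Subset n → Subset n → Bool
[]      ==ₛ []      = true
(a ∷ x) ==ₛ (b ∷ y) = (if a then b else not b) ∧ (x ==ₛ y)

_⊆ᵇ_ : {n : ℕ} → Subset n → Subset n → Bool
[]      ⊆ᵇ []      = true
(a ∷ x) ⊆ᵇ (b ∷ y) = (not a ∨ b) ∧ (x ⊆ᵇ y)

nonempty : {n : ℕ} → Subset n → Bool
nonempty []      = false
nonempty (a ∷ x) = a ∨ nonempty x

-- Binary matroids, represented by a matrix over GF(2) = Bool (with xor).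
-- A matrix with n columns (indexed by the ground set Fin n), each
-- column a vector in GF(2)^m.

Matrix : ℕ → ℕ → Set
Matrix m n = Vec (Vec Bool m) n

colSum : {m n : ℕ} → Matrix m n → Subset n → Vec Bool m
colSum {m} []      []      = replicate m false
colSum     (c ∷ A) (b ∷ X) =
  if b then zipWith _xor_ c (colSum A X) else colSum A X

isZero : {m : ℕ} → Vec Bool m → Bool
isZero []      = true
isZero (a ∷ v) = not a ∧ isZero v

zeroSumNonempty : {m n : ℕ} → Matrix m n → Subset n → Bool
zeroSumNonempty A Y = nonempty Y ∧ isZero (colSum A Y)

circuits : {m n : ℕ} → Matrix m n → Fam n
circuits {m} {n} A X =
  zeroSumNonempty A X ∧
  allL (λ Y → not ((Y ⊆ᵇ X) ∧ not (Y ==ₛ X) ∧ zeroSumNonempty A Y)) (subsets n)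

-- Simple: no loops (circuits of size 1) and no parallel elements
-- (circuits of size 2).
Simple : {m n : ℕ} → Matrix m n → Set
Simple {m} {n} A =
  (X : Subset n) → T (circuits A X) →
  T (not (∣ X ∣ ≡ᵇ 1)) × T (not (∣ X ∣ ≡ᵇ 2))

chordless : {m n : ℕ} → Matrix m n → Fam n
chordless {m} {n} A C =
  circuits A C ∧
  allL (λ C' → not (circuits A C' ∧ (∣ C' ─ C ∣ ≡ᵇ 1) ∧ (∣ C' ∣ <ᵇ ∣ C ∣)))
       (subsets n)

step : {n : ℕ} → Fam n → Fam n → Fam n
step {n} F G X =
  G X ∨
  (F X ∧
   anyL (λ X₁ → anyL (λ X₂ →
     G X₁ ∧ G X₂ ∧ not (X₁ ==ₛ X₂) ∧
     anyL (λ v → lookup X₁ v ∧ lookup X₂ v ∧ (X ==ₛ ((X₁ ∪ X₂) - v)))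
          (allFin n))
     (subsets n)) (subsets n))

iter : {n : ℕ} → Fam n → Fam n → ℕ → Fam n
iter F G zero    = G
iter F G (suc k) = step F (iter F G k)

-- ⟨G⟩_F : the stabilised family = union of all iterates (the iterates
-- increase and stabilise after finitely many steps).
Closure : {n : ℕ} → Fam n → Fam n → Subset n → Set
Closure F G X = Σ ℕ (λ k → T (iter F G k X))

IsGenerator : {n : ℕ} → Fam n → Fam n → Set
IsGenerator {n} F G =
  ((X : Subset n) → T (G X) → T (F X)) ×
  ((X : Subset n) → Closure F G X → T (F X)) ×
  ((X : Subset n) → T (F X) → Closure F G X)

card : {n : ℕ} → Fam n → ℕ
card {n} F = count (subsets n)
  where
  count : List (Subset n) → ℕ
  count []       = zero
  count (X ∷ Xs) = if F X then suc (count Xs) else count Xs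

-- Over GF(2) the column sums of sets add under symmetric difference ⊕, so X ⊕ Y is dependent
-- whenever X and Y are.
--
-- Generation: if a circuit C is not chordless, there is a circuit C' with C' ∖ C = {e} and
-- |C'| < |C|. Simplicity gives |C'| ≥ 3, hence |C ∩ C'| ≥ 2 and D = C ⊕ C' is shorter than C;
-- D is again a circuit, contains e, and C = (C' ∪ D) ∖ {e}. Induction on |C| shows that the
-- chordless circuits generate every circuit.
--
-- Minimality: suppose a chordless circuit C equals (X₁ ∪ X₂) ∖ {v} for distinct circuits X₁, X₂
-- through v. The dependent set X₁ ⊕ X₂ lies in C, so it is C; therefore X₁ ∩ X₂ = {v} and
-- Xᵢ ∖ C = {v}, and chordlessness gives |Xᵢ| ≥ |C|. Then 2|C| ≤ |X₁| + |X₂| = |C| + 2 contradicts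
-- |C| ≥ 3. So the operator ⟨_⟩¹ never produces a chordless circuit: every generator contains all
-- of them, which yields both the cardinality bound and uniqueness.

module Submission where

open import Defs
open import Data.Bool using (Bool; true; false; _∧_; _∨_; not; _xor_; if_then_else_; T)
open import Data.Bool.Properties using (T-∧; T-∨; T-≡; xor-assoc; xor-comm; xor-identityˡ; xor-identityʳ; xor-same)
open import Data.Empty using (⊥-elim)
open import Data.Fin using (Fin; zero; suc; _≟_)
open import Data.Fin.Subset
  using (Subset; _∈_; _∉_; _⊆_; _∪_; _∩_; _─_; _-_; ⁅_⁆; ∣_∣; Nonempty; inside; outside)
  renaming (⊥ to ∅)
open import Data.Fin.Subset.Properties
  using (_∈?_; drop-there; drop-∷-⊆; x∈⁅x⁆; x∈⁅y⁆⇒x≡y; ∣⁅x⁆∣≡1; ⊆-antisym; p⊆q⇒∣p∣≤∣q∣; ∣⊥∣≡0;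
         Empty-unique; nonempty?; x∈p∪q⁺; x∈p∪q⁻; x∈p∩q⁺; x∈p∩q⁻; p─q⊆p; ⊆-refl; x∈p∧x∉q⇒x∈p─q; x∈p∧x≢y⇒x∈p-y; ∪-comm; ∩-comm)
open import Data.List using (List; []; _∷_; map)
open import Data.Bool.ListAction using (all; any)
open import Data.List.Base using (allFin)
open import Data.List.Membership.Propositional using (lose) renaming (_∈_ to _∈ˡ_)
open import Data.List.Membership.Propositional.Properties using (∈-++⁺ˡ; ∈-++⁺ʳ; ∈-map⁺; ∈-allFin)
open import Data.List.Relation.Unary.All as All using (All)
open import Data.List.Relation.Unary.All.Properties using (all⁺; all⁻; ¬All⇒Any¬)
open import Data.List.Relation.Unary.Any using (Any; here; there; satisfied)
open import Data.List.Relation.Unary.Any.Properties using (any⁺; any⁻)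
open import Data.Nat using (ℕ; zero; suc; _+_; _⊔_; _≤_; _<_; _≤′_; ≤′-refl; ≤′-step; z≤n; s≤s; _≡ᵇ_; _<ᵇ_)
open import Data.Nat.Induction using (<-wellFounded)
open import Data.Nat.Properties using (suc-injective; +-mono-<-≤; +-mono-≤-<; +-comm; +-assoc; +-monoʳ-≤; +-cancelʳ-≡; ≤-pred; <-irrefl; +-suc; ≮⇒≥; <⇒≱; ≤-trans; ≤-reflexive; +-mono-≤; +-cancelˡ-≤; ≤⇒≤′; m≤m⊔n; m≤n⊔m; ≡ᵇ⇒≡; ≡⇒≡ᵇ; <ᵇ⇒<; <⇒<ᵇ)
open import Data.Nat.Tactic.RingSolver using (solve-∀)
open import Data.Product using (∃-syntax; _×_; _,_; proj₁; proj₂)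
open import Data.Sum as Sum using (_⊎_; inj₁; inj₂)
open import Data.Vec using (Vec; []; _∷_; lookup; replicate; zipWith; here; there)
open import Data.Vec.Properties using (zipWith-assoc; zipWith-comm; zipWith-identityˡ; zipWith-identityʳ; []=⇒lookup; lookup⇒[]=)
open import Function using (_∘_; _on_)
open import Function.Bundles using (Equivalence)
open import Relation.Binary.PropositionalEquality
  using (_≡_; _≢_; _≗_; refl; sym; trans; cong; cong₂; subst; subst₂; module ≡-Reasoning)
open import Induction.WellFounded using (Acc; acc)
import Relation.Binary.Construct.On as On
open import Relation.Nullary using (¬_; yes; no; contradiction)
open import Relation.Nullary.Decidable using (T?; decidable-stable)

private
  variable
    A : Set
    k m n : ℕ
    a b : Bool
    x v : Fin n
    p q X Y : Subset n

open ≡-Reasoning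

∧-elim : T (a ∧ b) → T a × T b
∧-elim = Equivalence.to T-∧

∧-intro : T a → T b → T (a ∧ b)
∧-intro ta tb = Equivalence.from T-∧ (ta , tb)

T-not⇒¬T : T (not a) → ¬ T a
T-not⇒¬T {false} _ ()

¬T⇒T-not : ¬ T a → T (not a)
¬T⇒T-not {true}  ¬t = ¬t _
¬T⇒T-not {false} _  = _

¬T-not⇒T : ¬ T (not a) → T a
¬T-not⇒T {true}  _   = _
¬T-not⇒T {false} ¬nt = ¬nt _

T-injective : (T a → T b) → (T b → T a) → a ≡ b
T-injective {false} {false} _ _ = refl
T-injective {false} {true}  _ f = ⊥-elim (f _)
T-injective {true}  {false} f _ = ⊥-elim (f _)
T-injective {true}  {true}  _ _ = refl

allL≡all : (P : A → Bool) (xs : List A) → allL P xs ≡ all P xs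
allL≡all P []       = refl
allL≡all P (x ∷ xs) = cong (P x ∧_) (allL≡all P xs)

anyL≡any : (P : A → Bool) (xs : List A) → anyL P xs ≡ any P xs
anyL≡any P []       = refl
anyL≡any P (x ∷ xs) = cong (P x ∨_) (anyL≡any P xs)

module _ {P : A → Bool} {xs : List A} where

  allL-sound : T (allL P xs) → All (T ∘ P) xs
  allL-sound = all⁺ P xs ∘ subst T (allL≡all P xs)

  allL-complete : All (T ∘ P) xs → T (allL P xs)
  allL-complete = subst T (sym (allL≡all P xs)) ∘ all⁻ P

  anyL-sound : T (anyL P xs) → Any (T ∘ P) xs
  anyL-sound = any⁻ P xs ∘ subst T (anyL≡any P xs)

  anyL-complete : Any (T ∘ P) xs → T (anyL P xs)
  anyL-complete = subst T (sym (anyL≡any P xs)) ∘ any⁺ P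

∈-subsets : (X : Subset n) → X ∈ˡ subsets n
∈-subsets []              = here refl
∈-subsets {suc n} (outside ∷ X) = ∈-++⁺ˡ (∈-map⁺ (outside ∷_) (∈-subsets X))
∈-subsets {suc n} (inside  ∷ X) = ∈-++⁺ʳ (map (outside ∷_) (subsets n)) (∈-map⁺ (inside ∷_) (∈-subsets X))

∈⇒T-lookup : x ∈ p → T (lookup p x)
∈⇒T-lookup x∈p = Equivalence.from T-≡ ([]=⇒lookup x∈p)

T-lookup⇒∈ : T (lookup p x) → x ∈ p
T-lookup⇒∈ {p = p} {x} t = lookup⇒[]= x p (Equivalence.to T-≡ t)

==ₛ⇒≡ : T (p ==ₛ q) → p ≡ q
==ₛ⇒≡ {p = []}          {[]}          _ = refl
==ₛ⇒≡ {p = inside  ∷ p} {inside  ∷ q} t = cong (inside ∷_) (==ₛ⇒≡ t)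
==ₛ⇒≡ {p = outside ∷ p} {outside ∷ q} t = cong (outside ∷_) (==ₛ⇒≡ t)

==ₛ-refl : (p : Subset n) → T (p ==ₛ p)
==ₛ-refl []            = _
==ₛ-refl (inside  ∷ p) = ==ₛ-refl p
==ₛ-refl (outside ∷ p) = ==ₛ-refl p

≡⇒==ₛ : p ≡ q → T (p ==ₛ q)
≡⇒==ₛ {p = p} refl = ==ₛ-refl p

⊆ᵇ⇒⊆ : T (p ⊆ᵇ q) → p ⊆ q
⊆ᵇ⇒⊆ {p = inside ∷ p}  {inside ∷ q}  t here         = here
⊆ᵇ⇒⊆ {p = inside ∷ p}  {inside ∷ q}  t (there x∈p) = there (⊆ᵇ⇒⊆ t x∈p)
⊆ᵇ⇒⊆ {p = outside ∷ p} {_ ∷ q}       t (there x∈p) = there (⊆ᵇ⇒⊆ t x∈p)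

⊆⇒⊆ᵇ : p ⊆ q → T (p ⊆ᵇ q)
⊆⇒⊆ᵇ {p = []}          {[]}          _   = _
⊆⇒⊆ᵇ {p = inside ∷ p}  {inside ∷ q}  p⊆q = ⊆⇒⊆ᵇ (drop-∷-⊆ p⊆q)
⊆⇒⊆ᵇ {p = inside ∷ p}  {outside ∷ q} p⊆q with () ← p⊆q here
⊆⇒⊆ᵇ {p = outside ∷ p} {_ ∷ q}       p⊆q = ⊆⇒⊆ᵇ (drop-∷-⊆ p⊆q)

nonempty⇒Nonempty : T (nonempty p) → Nonempty p
nonempty⇒Nonempty {p = inside  ∷ p} _ = zero , here
nonempty⇒Nonempty {p = outside ∷ p} t with x , x∈p ← nonempty⇒Nonempty t = suc x , there x∈p

Nonempty⇒nonempty : Nonempty p → T (nonempty p)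
Nonempty⇒nonempty {p = inside  ∷ p} _                = _
Nonempty⇒nonempty {p = outside ∷ p} (suc x , there x∈p) = Nonempty⇒nonempty (x , x∈p)

-- Symmetric difference and cardinalities

-- On subsets, _⊕_ is symmetric difference; on columns, addition in GF(2)^m.
infixl 6 _⊕_
_⊕_ : Vec Bool k → Vec Bool k → Vec Bool k
_⊕_ = zipWith _xor_

𝟎 : Vec Bool k
𝟎 = replicate _ false

module _ {k : ℕ} where

  ⊕-assoc : (u v w : Vec Bool k) → u ⊕ v ⊕ w ≡ u ⊕ (v ⊕ w)
  ⊕-assoc = zipWith-assoc xor-assoc

  ⊕-comm : (u v : Vec Bool k) → u ⊕ v ≡ v ⊕ u
  ⊕-comm = zipWith-comm xor-comm

  ⊕-identityˡ : (u : Vec Bool k) → 𝟎 ⊕ u ≡ u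
  ⊕-identityˡ = zipWith-identityˡ xor-identityˡ

  ⊕-identityʳ : (u : Vec Bool k) → u ⊕ 𝟎 ≡ u
  ⊕-identityʳ = zipWith-identityʳ xor-identityʳ

⊕-self : (u : Vec Bool k) → u ⊕ u ≡ 𝟎
⊕-self []      = refl
⊕-self (a ∷ u) = cong₂ _∷_ (xor-same a) (⊕-self u)

⊕-cancelʳ : (u v : Vec Bool k) → u ⊕ v ⊕ v ≡ u
⊕-cancelʳ u v = begin
  u ⊕ v ⊕ v   ≡⟨ ⊕-assoc u v v ⟩
  u ⊕ (v ⊕ v) ≡⟨ cong (u ⊕_) (⊕-self v) ⟩
  u ⊕ 𝟎       ≡⟨ ⊕-identityʳ u ⟩
  u           ∎

⊕-leftComm : (u v w : Vec Bool k) → u ⊕ (v ⊕ w) ≡ v ⊕ (u ⊕ w)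
⊕-leftComm u v w = begin
  u ⊕ (v ⊕ w) ≡⟨ ⊕-assoc u v w ⟨
  u ⊕ v ⊕ w   ≡⟨ cong (_⊕ w) (⊕-comm u v) ⟩
  v ⊕ u ⊕ w   ≡⟨ ⊕-assoc v u w ⟩
  v ⊕ (u ⊕ w) ∎

⊕-cancel-common : (u v w : Vec Bool k) → u ⊕ v ⊕ (u ⊕ w) ≡ v ⊕ w
⊕-cancel-common u v w = begin
  u ⊕ v ⊕ (u ⊕ w)   ≡⟨ ⊕-assoc u v (u ⊕ w) ⟩
  u ⊕ (v ⊕ (u ⊕ w)) ≡⟨ cong (u ⊕_) (⊕-leftComm v u w) ⟩
  u ⊕ (u ⊕ (v ⊕ w)) ≡⟨ ⊕-assoc u u (v ⊕ w) ⟨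
  u ⊕ u ⊕ (v ⊕ w)   ≡⟨ cong (_⊕ (v ⊕ w)) (⊕-self u) ⟩
  𝟎 ⊕ (v ⊕ w)       ≡⟨ ⊕-identityˡ (v ⊕ w) ⟩
  v ⊕ w             ∎

⊕≡𝟎⇒≡ : (u v : Vec Bool k) → u ⊕ v ≡ 𝟎 → u ≡ v
⊕≡𝟎⇒≡ u v u⊕v≡𝟎 = begin
  u         ≡⟨ ⊕-cancelʳ u v ⟨
  u ⊕ v ⊕ v ≡⟨ cong (_⊕ v) u⊕v≡𝟎 ⟩
  𝟎 ⊕ v     ≡⟨ ⊕-identityˡ v ⟩
  v         ∎

x∈p⊕q⁻ : x ∈ p ⊕ q → x ∈ p × x ∉ q ⊎ x ∉ p × x ∈ q
x∈p⊕q⁻ {p = inside  ∷ p} {outside ∷ q} here = inj₁ (here , λ ())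
x∈p⊕q⁻ {p = outside ∷ p} {inside  ∷ q} here = inj₂ ((λ ()) , here)
x∈p⊕q⁻ {p = _ ∷ p} {_ ∷ q} (there x∈p⊕q) with x∈p⊕q⁻ x∈p⊕q
... | inj₁ (x∈p , x∉q) = inj₁ (there x∈p , x∉q ∘ drop-there)
... | inj₂ (x∉p , x∈q) = inj₂ (x∉p ∘ drop-there , there x∈q)

x∈p⊕q⁺ : x ∈ p × x ∉ q ⊎ x ∉ p × x ∈ q → x ∈ p ⊕ q
x∈p⊕q⁺ {p = inside  ∷ p} {outside ∷ q} (inj₁ (here , _))          = here
x∈p⊕q⁺ {p = inside  ∷ p} {inside  ∷ q} (inj₁ (here , x∉q))        = contradiction here x∉q
x∈p⊕q⁺ {p = _ ∷ p}       {_ ∷ q}       (inj₁ (there x∈p , x∉q))  = there (x∈p⊕q⁺ (inj₁ (x∈p , x∉q ∘ there)))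
x∈p⊕q⁺ {p = outside ∷ p} {inside  ∷ q} (inj₂ (_ , here))          = here
x∈p⊕q⁺ {p = inside  ∷ p} {inside  ∷ q} (inj₂ (x∉p , here))        = contradiction here x∉p
x∈p⊕q⁺ {p = _ ∷ p}       {_ ∷ q}       (inj₂ (x∉p , there x∈q))  = there (x∈p⊕q⁺ (inj₂ (x∉p ∘ there , x∈q)))

x∈p∩q⇒x∉p⊕q : x ∈ p → x ∈ q → x ∉ p ⊕ q
x∈p∩q⇒x∉p⊕q x∈p x∈q x∈p⊕q with x∈p⊕q⁻ x∈p⊕q
... | inj₁ (_ , x∉q) = x∉q x∈q
... | inj₂ (x∉p , _) = x∉p x∈p

x∈p─q⇒x∉q : x ∈ p ─ q → x ∉ q
x∈p─q⇒x∉q {p = _ ∷ p} {outside ∷ q} (there x∈p─q) (there x∈q) = x∈p─q⇒x∉q x∈p─q x∈q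
x∈p─q⇒x∉q {p = _ ∷ p} {inside  ∷ q} (there x∈p─q) (there x∈q) = x∈p─q⇒x∉q x∈p─q x∈q

x∉p-x : (p : Subset n) → x ∉ p - x
x∉p-x {x = x} p x∈p-x = x∈p─q⇒x∉q x∈p-x (x∈⁅x⁆ x)

x∈p-v⇒x≢v : x ∈ p - v → x ≢ v
x∈p-v⇒x≢v {p = p} x∈p-v refl = x∉p-x p x∈p-v

∣p∣≡0⇒p≡∅ : ∣ p ∣ ≡ 0 → p ≡ ∅
∣p∣≡0⇒p≡∅ {p = []}          _ = refl
∣p∣≡0⇒p≡∅ {p = outside ∷ p} ∣p∣≡0 = cong (outside ∷_) (∣p∣≡0⇒p≡∅ ∣p∣≡0)

∣p∣≡1⇒p≡⁅x⁆ : ∣ p ∣ ≡ 1 → ∃[ x ] p ≡ ⁅ x ⁆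
∣p∣≡1⇒p≡⁅x⁆ {p = inside  ∷ p} ∣p∣≡1 = zero , cong (inside ∷_) (∣p∣≡0⇒p≡∅ (suc-injective ∣p∣≡1))
∣p∣≡1⇒p≡⁅x⁆ {p = outside ∷ p} ∣p∣≡1 with x , p≡⁅x⁆ ← ∣p∣≡1⇒p≡⁅x⁆ ∣p∣≡1 = suc x , cong (outside ∷_) p≡⁅x⁆

v∈p⇒⁅v⁆⊆p : v ∈ p → ⁅ v ⁆ ⊆ p
v∈p⇒⁅v⁆⊆p {v = v} {p} v∈p x∈⁅v⁆ = subst (_∈ p) (sym (x∈⁅y⁆⇒x≡y v x∈⁅v⁆)) v∈p

Nonempty⇒∣p∣>0 : Nonempty p → 0 < ∣ p ∣
Nonempty⇒∣p∣>0 {p = p} (x , x∈p) = subst (_≤ ∣ p ∣) (∣⁅x⁆∣≡1 x) (p⊆q⇒∣p∣≤∣q∣ (v∈p⇒⁅v⁆⊆p x∈p))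

≢⇒Nonempty[p⊕q] : p ≢ q → Nonempty (p ⊕ q)
≢⇒Nonempty[p⊕q] {p = p} {q} p≢q with nonempty? (p ⊕ q)
... | yes ne  = ne
... | no  ¬ne = contradiction (⊕≡𝟎⇒≡ p q (Empty-unique ¬ne)) p≢q

∣p∣>0⇒Nonempty : 0 < ∣ p ∣ → Nonempty p
∣p∣>0⇒Nonempty {n} {p} ∣p∣>0 with nonempty? p
... | yes ne = ne
... | no  ¬ne = contradiction ∣p∣>0 (<-irrefl (sym (trans (cong ∣_∣ (Empty-unique ¬ne)) (∣⊥∣≡0 n))))

∣p∣+∣q∣≡∣p⊕q∣+2∣p∩q∣ : (p q : Subset n) → ∣ p ∣ + ∣ q ∣ ≡ ∣ p ⊕ q ∣ + (∣ p ∩ q ∣ + ∣ p ∩ q ∣)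
∣p∣+∣q∣≡∣p⊕q∣+2∣p∩q∣ []            []            = refl
∣p∣+∣q∣≡∣p⊕q∣+2∣p∩q∣ (inside  ∷ p) (inside  ∷ q) = begin
  suc ∣ p ∣ + suc ∣ q ∣                        ≡⟨ cong suc (+-suc ∣ p ∣ ∣ q ∣) ⟩
  suc (suc (∣ p ∣ + ∣ q ∣))                     ≡⟨ cong (2 +_) (∣p∣+∣q∣≡∣p⊕q∣+2∣p∩q∣ p q) ⟩
  suc (suc (∣ p ⊕ q ∣ + (∣ p ∩ q ∣ + ∣ p ∩ q ∣))) ≡⟨ shift ∣ p ⊕ q ∣ ∣ p ∩ q ∣ ⟩
  ∣ p ⊕ q ∣ + (suc ∣ p ∩ q ∣ + suc ∣ p ∩ q ∣)     ∎
  where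
  shift : ∀ d i → suc (suc (d + (i + i))) ≡ d + (suc i + suc i)
  shift = solve-∀
∣p∣+∣q∣≡∣p⊕q∣+2∣p∩q∣ (inside  ∷ p) (outside ∷ q) = cong suc (∣p∣+∣q∣≡∣p⊕q∣+2∣p∩q∣ p q)
∣p∣+∣q∣≡∣p⊕q∣+2∣p∩q∣ (outside ∷ p) (inside  ∷ q) = trans (+-suc ∣ p ∣ ∣ q ∣) (cong suc (∣p∣+∣q∣≡∣p⊕q∣+2∣p∩q∣ p q))
∣p∣+∣q∣≡∣p⊕q∣+2∣p∩q∣ (outside ∷ p) (outside ∷ q) = ∣p∣+∣q∣≡∣p⊕q∣+2∣p∩q∣ p q

∣p─q∣+∣p∩q∣≡∣p∣ : (p q : Subset n) → ∣ p ─ q ∣ + ∣ p ∩ q ∣ ≡ ∣ p ∣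
∣p─q∣+∣p∩q∣≡∣p∣ []            []            = refl
∣p─q∣+∣p∩q∣≡∣p∣ (inside  ∷ p) (inside  ∷ q) = trans (+-suc ∣ p ─ q ∣ ∣ p ∩ q ∣) (cong suc (∣p─q∣+∣p∩q∣≡∣p∣ p q))
∣p─q∣+∣p∩q∣≡∣p∣ (inside  ∷ p) (outside ∷ q) = cong suc (∣p─q∣+∣p∩q∣≡∣p∣ p q)
∣p─q∣+∣p∩q∣≡∣p∣ (outside ∷ p) (inside  ∷ q) = ∣p─q∣+∣p∩q∣≡∣p∣ p q
∣p─q∣+∣p∩q∣≡∣p∣ (outside ∷ p) (outside ∷ q) = ∣p─q∣+∣p∩q∣≡∣p∣ p q

¬x≢v⇒x∈⁅v⁆ : ¬ x ≢ v → x ∈ ⁅ v ⁆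
¬x≢v⇒x∈⁅v⁆ {x = x} {v} ¬x≢v = subst (_∈ ⁅ v ⁆) (sym (decidable-stable (x ≟ v) ¬x≢v)) (x∈⁅x⁆ v)

p⊕q⊆[p∪q]-v : v ∈ p → v ∈ q → p ⊕ q ⊆ (p ∪ q) - v
p⊕q⊆[p∪q]-v {v = v} v∈p v∈q {x} x∈p⊕q = x∈p∧x≢y⇒x∈p-y x∈p∪q x≢v
  where
  x∈p∪q : x ∈ _ ∪ _
  x∈p∪q = x∈p∪q⁺ (Sum.map proj₁ proj₂ (x∈p⊕q⁻ x∈p⊕q))
  x≢v : x ≢ v
  x≢v refl = x∈p∩q⇒x∉p⊕q v∈p v∈q x∈p⊕q

p─[p∪q]-v≡⁅v⁆ : v ∈ p → p ─ ((p ∪ q) - v) ≡ ⁅ v ⁆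
p─[p∪q]-v≡⁅v⁆ {v = v} {p} {q} v∈p = ⊆-antisym ⊆⁅v⁆ ⁅v⁆⊆
  where
  ⊆⁅v⁆ : p ─ ((p ∪ q) - v) ⊆ ⁅ v ⁆
  ⊆⁅v⁆ {x} x∈ = ¬x≢v⇒x∈⁅v⁆ λ x≢v →
    x∈p─q⇒x∉q x∈ (x∈p∧x≢y⇒x∈p-y (x∈p∪q⁺ (inj₁ (p─q⊆p p _ x∈))) x≢v)
  ⁅v⁆⊆ : ⁅ v ⁆ ⊆ p ─ ((p ∪ q) - v)
  ⁅v⁆⊆ = v∈p⇒⁅v⁆⊆p (x∈p∧x∉q⇒x∈p─q v∈p (x∉p-x (p ∪ q)))

p⊕q≡[p∪q]-v⇒p∩q≡⁅v⁆ : v ∈ p → v ∈ q → p ⊕ q ≡ (p ∪ q) - v → p ∩ q ≡ ⁅ v ⁆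
p⊕q≡[p∪q]-v⇒p∩q≡⁅v⁆ {v = v} {p} {q} v∈p v∈q p⊕q≡ = ⊆-antisym ⊆⁅v⁆ ⁅v⁆⊆
  where
  ⊆⁅v⁆ : p ∩ q ⊆ ⁅ v ⁆
  ⊆⁅v⁆ {x} x∈p∩q = ¬x≢v⇒x∈⁅v⁆ λ x≢v →
    let x∈p , x∈q = x∈p∩q⁻ p q x∈p∩q
    in x∈p∩q⇒x∉p⊕q x∈p x∈q (subst (x ∈_) (sym p⊕q≡) (x∈p∧x≢y⇒x∈p-y (x∈p∪q⁺ (inj₁ x∈p)) x≢v))
  ⁅v⁆⊆ : ⁅ v ⁆ ⊆ p ∩ q
  ⁅v⁆⊆ = v∈p⇒⁅v⁆⊆p (x∈p∩q⁺ (v∈p , v∈q))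

module _ {p q : Subset n} {e : Fin n} (q─p≡⁅e⁆ : q ─ p ≡ ⁅ e ⁆) where

  private
    e∈q─p : e ∈ q ─ p
    e∈q─p = subst (e ∈_) (sym q─p≡⁅e⁆) (x∈⁅x⁆ e)

  q─p≡⁅e⁆⇒e∈q : e ∈ q
  q─p≡⁅e⁆⇒e∈q = p─q⊆p q p e∈q─p

  q─p≡⁅e⁆⇒e∉p : e ∉ p
  q─p≡⁅e⁆⇒e∉p = x∈p─q⇒x∉q e∈q─p

  q─p≡⁅e⁆⇒q-e⊆p : x ∈ q → x ≢ e → x ∈ p
  q─p≡⁅e⁆⇒q-e⊆p {x} x∈q x≢e with x ∈? p
  ... | yes x∈p = x∈p
  ... | no  x∉p = contradiction (x∈⁅y⁆⇒x≡y e (subst (x ∈_) q─p≡⁅e⁆ (x∈p∧x∉q⇒x∈p─q x∈q x∉p))) x≢e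

  q─p≡⁅e⁆⇒p≡[q∪p⊕q]-e : p ≡ (q ∪ (p ⊕ q)) - e
  q─p≡⁅e⁆⇒p≡[q∪p⊕q]-e = ⊆-antisym ⊆[q∪p⊕q]-e [q∪p⊕q]-e⊆
    where
    ⊆[q∪p⊕q]-e : p ⊆ (q ∪ (p ⊕ q)) - e
    ⊆[q∪p⊕q]-e {x} x∈p = x∈p∧x≢y⇒x∈p-y (x∈p∪q⁺ x∈q⊎x∈p⊕q) x≢e
      where
      x≢e : x ≢ e
      x≢e refl = q─p≡⁅e⁆⇒e∉p x∈p
      x∈q⊎x∈p⊕q : x ∈ q ⊎ x ∈ p ⊕ q
      x∈q⊎x∈p⊕q with x ∈? q
      ... | yes x∈q = inj₁ x∈q
      ... | no  x∉q = inj₂ (x∈p⊕q⁺ (inj₁ (x∈p , x∉q)))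
    [q∪p⊕q]-e⊆ : (q ∪ (p ⊕ q)) - e ⊆ p
    [q∪p⊕q]-e⊆ {x} x∈ with x∈p∪q⁻ q (p ⊕ q) (p─q⊆p _ _ x∈)
    ... | inj₁ x∈q   = q─p≡⁅e⁆⇒q-e⊆p x∈q (x∈p-v⇒x≢v x∈)
    ... | inj₂ x∈p⊕q with x∈p⊕q⁻ x∈p⊕q
    ...   | inj₁ (x∈p , _) = x∈p
    ...   | inj₂ (_ , x∈q) = q─p≡⁅e⁆⇒q-e⊆p x∈q (x∈p-v⇒x≢v x∈)

-- The closure ⟨G⟩_F

_⊆ᶠ_ : Fam n → Fam n → Set
F ⊆ᶠ G = ∀ X → T (F X) → T (G X)

record Join (P : Subset n → Set) (X : Subset n) : Set where
  constructor join
  field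
    X₁ X₂    : Subset n
    pivot    : Fin n
    P-X₁     : P X₁
    P-X₂     : P X₂
    X₁≢X₂    : X₁ ≢ X₂
    pivot∈X₁ : pivot ∈ X₁
    pivot∈X₂ : pivot ∈ X₂
    X≡       : X ≡ (X₁ ∪ X₂) - pivot

Join-map : {P Q : Subset n → Set} → (∀ {Y} → P Y → Q Y) → Join P X → Join Q X
Join-map f (join X₁ X₂ v P-X₁ P-X₂ X₁≢X₂ v∈X₁ v∈X₂ X≡) = join X₁ X₂ v (f P-X₁) (f P-X₂) X₁≢X₂ v∈X₁ v∈X₂ X≡

module _ (F : Fam n) where

  step-sound : (G : Fam n) → T (step F G X) → T (G X) ⊎ T (F X) × Join (T ∘ G) X
  step-sound {X} G t with Equivalence.to (T-∨ {G X}) t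
  ... | inj₁ G-X = inj₁ G-X
  ... | inj₂ u =
    -- Unification cannot decompose _∧_ or anyL applied to metas, so their first arguments are supplied.
    let F-X   , t₁  = ∧-elim {F X} u
        X₁    , t₂  = satisfied (anyL-sound {xs = subsets n} t₁)
        X₂    , t₃  = satisfied (anyL-sound {xs = subsets n} t₂)
        G-X₁  , t₄  = ∧-elim {G X₁} t₃
        G-X₂  , t₅  = ∧-elim {G X₂} t₄
        X₁≠X₂ , t₆  = ∧-elim {not (X₁ ==ₛ X₂)} t₅
        v     , t₇  = satisfied (anyL-sound {xs = allFin n} t₆)
        v∈X₁  , t₈  = ∧-elim {lookup X₁ v} t₇
        v∈X₂  , X== = ∧-elim {lookup X₂ v} t₈
    in inj₂ (F-X , join X₁ X₂ v G-X₁ G-X₂ (T-not⇒¬T X₁≠X₂ ∘ ≡⇒==ₛ) (T-lookup⇒∈ v∈X₁) (T-lookup⇒∈ v∈X₂) (==ₛ⇒≡ X==))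

  step-complete : (G : Fam n) → T (F X) → Join (T ∘ G) X → T (step F G X)
  step-complete {X} G F-X (join X₁ X₂ v G-X₁ G-X₂ X₁≢X₂ v∈X₁ v∈X₂ X≡) =
    Equivalence.from T-∨ (inj₂ (∧-intro F-X
      (anyL-complete (lose (∈-subsets X₁) (anyL-complete (lose (∈-subsets X₂) joined))))))
    where
    joined : T (G X₁ ∧ G X₂ ∧ not (X₁ ==ₛ X₂) ∧
                anyL (λ u → lookup X₁ u ∧ lookup X₂ u ∧ (X ==ₛ ((X₁ ∪ X₂) - u))) (allFin n))
    joined = ∧-intro G-X₁ (∧-intro G-X₂ (∧-intro (¬T⇒T-not (X₁≢X₂ ∘ ==ₛ⇒≡))
      (anyL-complete (lose (∈-allFin v) (∧-intro (∈⇒T-lookup v∈X₁) (∧-intro (∈⇒T-lookup v∈X₂) (≡⇒==ₛ X≡)))))))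

module _ (F G : Fam n) where

  iter-mono : ∀ {i j} → i ≤′ j → T (iter F G i X) → T (iter F G j X)
  iter-mono ≤′-refl          t = t
  iter-mono (≤′-step i≤′j) t = Equivalence.from T-∨ (inj₁ (iter-mono i≤′j t))

  iter⊆F : G ⊆ᶠ F → ∀ i → T (iter F G i X) → T (F X)
  iter⊆F G⊆F zero    t = G⊆F _ t
  iter⊆F G⊆F (suc i) t with step-sound F (iter F G i) t
  ... | inj₁ t′       = iter⊆F G⊆F i t′
  ... | inj₂ (F-X , _) = F-X

  Closure⊆F : G ⊆ᶠ F → ∀ X → Closure F G X → T (F X)
  Closure⊆F G⊆F X (i , t) = iter⊆F G⊆F i t

  Closure-join : T (F X) → Join (Closure F G) X → Closure F G X
  Closure-join F-X (join X₁ X₂ v (i₁ , t₁) (i₂ , t₂) X₁≢X₂ v∈X₁ v∈X₂ X≡) =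
    suc (i₁ ⊔ i₂) , step-complete F (iter F G (i₁ ⊔ i₂)) F-X
      (join X₁ X₂ v (iter-mono (≤⇒≤′ (m≤m⊔n i₁ i₂)) t₁) (iter-mono (≤⇒≤′ (m≤n⊔m i₁ i₂)) t₂) X₁≢X₂ v∈X₁ v∈X₂ X≡)

  Closure-unjoinable : G ⊆ᶠ F → ¬ Join (T ∘ F) X → Closure F G X → T (G X)
  Closure-unjoinable {X} G⊆F ¬join (i , t) = iter-unjoinable i t
    where
    iter-unjoinable : ∀ i → T (iter F G i X) → T (G X)
    iter-unjoinable zero    t = t
    iter-unjoinable (suc i) t with step-sound F (iter F G i) t
    ... | inj₁ t′             = iter-unjoinable i t′
    ... | inj₂ (_ , joinable) = contradiction (Join-map (iter⊆F G⊆F i) joinable) ¬join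

-- Cardinality of families

χ : Bool → ℕ
χ b = if b then 1 else 0

record IsCount (F : Fam n) (count : List (Subset n) → ℕ) : Set where
  field
    count-[] : count [] ≡ 0
    count-∷  : ∀ X Xs → count (X ∷ Xs) ≡ χ (F X) + count Xs

-- Defs counts card F with a function local to its definition; unification recovers it.
card-as-count : (F : Fam n) → ∃[ count ] IsCount F count × card F ≡ count (subsets n)
card-as-count {n} F = count , record { count-[] = refl ; count-∷ = λ X _ → if-suc (F X) } , unfold-card
  where
  count : List (Subset n) → ℕ
  count = _
  unfold-card : card F ≡ count (subsets n)
  unfold-card with subsets n
  ... | _ = refl
  if-suc : ∀ {i} b → (if b then suc i else i) ≡ χ b + i
  if-suc true  = refl
  if-suc false = refl

χ-mono : (T a → T b) → χ a ≤ χ b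
χ-mono {false}          _   = z≤n
χ-mono {true}  {true}   _   = s≤s z≤n
χ-mono {true}  {false}  a⇒b = ⊥-elim (a⇒b _)

χ-< : ¬ T a → T b → χ a < χ b
χ-< {false} {true} _  _ = s≤s z≤n
χ-< {true}         ¬a _ = ⊥-elim (¬a _)

module _ {F G : Fam n} {c d : List (Subset n) → ℕ} (cF : IsCount F c) (cG : IsCount G d) (F⊆G : F ⊆ᶠ G) where

  private
    by-count-∷ : ∀ {R : ℕ → ℕ → Set} X Xs → R (χ (F X) + c Xs) (χ (G X) + d Xs) → R (c (X ∷ Xs)) (d (X ∷ Xs))
    by-count-∷ {R} X Xs = subst₂ R (sym (IsCount.count-∷ cF X Xs)) (sym (IsCount.count-∷ cG X Xs))

  count-mono : ∀ Xs → c Xs ≤ d Xs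
  count-mono []       = subst₂ _≤_ (sym (IsCount.count-[] cF)) (sym (IsCount.count-[] cG)) z≤n
  count-mono (X ∷ Xs) = by-count-∷ {_≤_} X Xs (+-mono-≤ (χ-mono (F⊆G X)) (count-mono Xs))

  count-< : {X : Subset n} {Xs : List (Subset n)} → X ∈ˡ Xs → T (G X) → ¬ T (F X) → c Xs < d Xs
  count-< {Xs = X ∷ Xs} (here refl)   G-X ¬F-X = by-count-∷ {_<_} X Xs (+-mono-<-≤ (χ-< ¬F-X G-X) (count-mono Xs))
  count-< {Xs = Y ∷ Xs} (there X∈Xs) G-X ¬F-X = by-count-∷ {_<_} Y Xs (+-mono-≤-< (χ-mono (F⊆G Y)) (count-< X∈Xs G-X ¬F-X))

module _ {F G : Fam n} (F⊆G : F ⊆ᶠ G) where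

  card-mono : card F ≤ card G
  card-mono with c , cF , card≡c ← card-as-count F | d , cG , card≡d ← card-as-count G =
    subst₂ _≤_ (sym card≡c) (sym card≡d) (count-mono cF cG F⊆G (subsets n))

  card-< : T (G X) → ¬ T (F X) → card F < card G
  card-< {X} G-X ¬F-X with c , cF , card≡c ← card-as-count F | d , cG , card≡d ← card-as-count G =
    subst₂ _<_ (sym card≡c) (sym card≡d) (count-< cF cG F⊆G (∈-subsets X) G-X ¬F-X)

  card≡⇒≗ : card G ≡ card F → G ≗ F
  card≡⇒≗ card≡ X = T-injective G⇒F (F⊆G X)
    where
    G⇒F : T (G X) → T (F X)
    G⇒F G-X = decidable-stable (T? (F X)) λ ¬F-X → <-irrefl (sym card≡) (card-< G-X ¬F-X)

-- Circuits of a binary matroid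

colSum-⊕ : (M : Matrix m n) (X Y : Subset n) → colSum M (X ⊕ Y) ≡ colSum M X ⊕ colSum M Y
colSum-⊕ []      []            []            = sym (⊕-self 𝟎)
colSum-⊕ (c ∷ M) (inside  ∷ X) (inside  ∷ Y) = trans (colSum-⊕ M X Y) (sym (⊕-cancel-common c (colSum M X) (colSum M Y)))
colSum-⊕ (c ∷ M) (inside  ∷ X) (outside ∷ Y) = trans (cong (c ⊕_) (colSum-⊕ M X Y)) (sym (⊕-assoc c (colSum M X) (colSum M Y)))
colSum-⊕ (c ∷ M) (outside ∷ X) (inside  ∷ Y) = trans (cong (c ⊕_) (colSum-⊕ M X Y)) (⊕-leftComm c (colSum M X) (colSum M Y))
colSum-⊕ (c ∷ M) (outside ∷ X) (outside ∷ Y) = colSum-⊕ M X Y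

ZeroSum : Matrix m n → Subset n → Set
ZeroSum M X = colSum M X ≡ 𝟎

ZeroSum-⊕ : (M : Matrix m n) → ZeroSum M X → ZeroSum M Y → ZeroSum M (X ⊕ Y)
ZeroSum-⊕ {X = X} {Y} M zX zY = begin
  colSum M (X ⊕ Y)          ≡⟨ colSum-⊕ M X Y ⟩
  colSum M X ⊕ colSum M Y   ≡⟨ cong₂ _⊕_ zX zY ⟩
  𝟎 ⊕ 𝟎                     ≡⟨ ⊕-self 𝟎 ⟩
  𝟎                         ∎

isZero⇒≡𝟎 : (u : Vec Bool k) → T (isZero u) → u ≡ 𝟎
isZero⇒≡𝟎 []          _ = refl
isZero⇒≡𝟎 (false ∷ u) t = cong (false ∷_) (isZero⇒≡𝟎 u t)

isZero-𝟎 : (k : ℕ) → T (isZero (𝟎 {k}))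
isZero-𝟎 zero    = _
isZero-𝟎 (suc k) = isZero-𝟎 k

record IsCircuit (M : Matrix m n) (C : Subset n) : Set where
  field
    nonEmpty : Nonempty C
    zeroSum  : ZeroSum M C
    minimal  : ∀ {Y} → Y ⊆ C → Nonempty Y → ZeroSum M Y → Y ≡ C

module _ (M : Matrix m n) where

  zeroSumNonempty-sound : T (zeroSumNonempty M X) → Nonempty X × ZeroSum M X
  zeroSumNonempty-sound t =
    let ne , z = ∧-elim t in nonempty⇒Nonempty ne , isZero⇒≡𝟎 _ z

  zeroSumNonempty-complete : Nonempty X → ZeroSum M X → T (zeroSumNonempty M X)
  zeroSumNonempty-complete ne z = ∧-intro (Nonempty⇒nonempty ne) (subst (T ∘ isZero) (sym z) (isZero-𝟎 m))

  circuit-sound : T (circuits M X) → IsCircuit M X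
  circuit-sound {X} t = record
    { nonEmpty = proj₁ (zeroSumNonempty-sound zsn)
    ; zeroSum  = proj₂ (zeroSumNonempty-sound zsn)
    ; minimal  = minimal
    }
    where
    zsn : T (zeroSumNonempty M X)
    zsn = proj₁ (∧-elim t)
    minimal : Y ⊆ X → Nonempty Y → ZeroSum M Y → Y ≡ X
    minimal {Y} Y⊆X neY zY with T? (Y ==ₛ X)
    ... | yes Y==X = ==ₛ⇒≡ Y==X
    ... | no  Y≠X  = contradiction
      (∧-intro (⊆⇒⊆ᵇ Y⊆X) (∧-intro (¬T⇒T-not Y≠X) (zeroSumNonempty-complete neY zY)))
      (T-not⇒¬T (All.lookup (allL-sound (proj₂ (∧-elim t))) (∈-subsets Y)))

  circuit-complete : IsCircuit M X → T (circuits M X)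
  circuit-complete {X} c = ∧-intro
    (zeroSumNonempty-complete (IsCircuit.nonEmpty c) (IsCircuit.zeroSum c))
    (allL-complete (All.universal noProperSubcircuit (subsets n)))
    where
    noProperSubcircuit : ∀ Y → T (not ((Y ⊆ᵇ X) ∧ not (Y ==ₛ X) ∧ zeroSumNonempty M Y))
    noProperSubcircuit Y = ¬T⇒T-not λ t →
      let Y⊆ᵇX , rest  = ∧-elim t
          Y≠X  , zsnY  = ∧-elim rest
          neY  , zY    = zeroSumNonempty-sound zsnY
          Y≡X = IsCircuit.minimal c (⊆ᵇ⇒⊆ Y⊆ᵇX) neY zY
      in T-not⇒¬T Y≠X (subst (λ Z → T (Y ==ₛ Z)) Y≡X (==ₛ-refl Y))

  Chord : Subset n → Set
  Chord C = ∃[ C' ] IsCircuit M C' × ∣ C' ─ C ∣ ≡ 1 × ∣ C' ∣ < ∣ C ∣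

  chordless⇒circuit : T (chordless M X) → T (circuits M X)
  chordless⇒circuit = proj₁ ∘ ∧-elim

  chordless⇒¬Chord : T (chordless M X) → ¬ Chord X
  chordless⇒¬Chord t (C' , c' , ∣C'─X∣≡1 , ∣C'∣<∣X∣) =
    T-not⇒¬T (All.lookup (allL-sound (proj₂ (∧-elim t))) (∈-subsets C'))
      (∧-intro (circuit-complete c') (∧-intro (≡⇒≡ᵇ _ _ ∣C'─X∣≡1) (<⇒<ᵇ ∣C'∣<∣X∣)))

  isChord : Subset n → Subset n → Bool
  isChord X C' = circuits M C' ∧ (∣ C' ─ X ∣ ≡ᵇ 1) ∧ (∣ C' ∣ <ᵇ ∣ X ∣)

  circuit⇒chordless⊎Chord : T (circuits M X) → T (chordless M X) ⊎ Chord X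
  circuit⇒chordless⊎Chord {X} t with T? (allL (not ∘ isChord X) (subsets n))
  ... | yes all = inj₁ (∧-intro t all)
  ... | no ¬all with C' , chord ← satisfied (¬All⇒Any¬ (T? ∘ not ∘ isChord X) (subsets n) (¬all ∘ allL-complete)) =
    let c' , rest = ∧-elim (¬T-not⇒T chord)
        one  , lt = ∧-elim rest
    in inj₂ (C' , circuit-sound c' , ≡ᵇ⇒≡ _ _ one , <ᵇ⇒< _ _ lt)

Simple⇒3≤∣C∣ : {M : Matrix m n} {C : Subset n} → Simple M → IsCircuit M C → 3 ≤ ∣ C ∣
Simple⇒3≤∣C∣ {C = C} simple c =
  3≤ (Nonempty⇒∣p∣>0 (IsCircuit.nonEmpty c)) (simple C (circuit-complete _ c))
  where
  3≤ : ∀ {i} → 0 < i → T (not (i ≡ᵇ 1)) × T (not (i ≡ᵇ 2)) → 3 ≤ i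
  3≤ {suc (suc (suc i))} _ _ = s≤s (s≤s (s≤s z≤n))

module _ (M : Matrix m n) (simple : Simple M) where

  chordless-unjoinable : {C : Subset n} → T (chordless M C) → ¬ Join (IsCircuit M) C
  chordless-unjoinable {C} ch (join X₁ X₂ v c₁ c₂ X₁≢X₂ v∈X₁ v∈X₂ C≡) =
    <⇒≱ (Simple⇒3≤∣C∣ simple c) ∣C∣≤2
    where
    c : IsCircuit M C
    c = circuit-sound M (chordless⇒circuit M ch)
    X₁⊕X₂≡C : X₁ ⊕ X₂ ≡ C
    X₁⊕X₂≡C = IsCircuit.minimal c
      (subst (X₁ ⊕ X₂ ⊆_) (sym C≡) (p⊕q⊆[p∪q]-v v∈X₁ v∈X₂))
      (≢⇒Nonempty[p⊕q] X₁≢X₂)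
      (ZeroSum-⊕ M (IsCircuit.zeroSum c₁) (IsCircuit.zeroSum c₂))
    ∣X₁∩X₂∣≡1 : ∣ X₁ ∩ X₂ ∣ ≡ 1
    ∣X₁∩X₂∣≡1 = trans (cong ∣_∣ (p⊕q≡[p∪q]-v⇒p∩q≡⁅v⁆ v∈X₁ v∈X₂ (trans X₁⊕X₂≡C C≡))) (∣⁅x⁆∣≡1 v)
    no-shorter : {Y : Subset n} → IsCircuit M Y → Y ─ C ≡ ⁅ v ⁆ → ∣ C ∣ ≤ ∣ Y ∣
    no-shorter {Y} cY Y─C≡⁅v⁆ = ≮⇒≥ λ ∣Y∣<∣C∣ →
      chordless⇒¬Chord M ch (Y , cY , trans (cong ∣_∣ Y─C≡⁅v⁆) (∣⁅x⁆∣≡1 v) , ∣Y∣<∣C∣)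
    ∣C∣≤∣X₁∣ : ∣ C ∣ ≤ ∣ X₁ ∣
    ∣C∣≤∣X₁∣ = no-shorter c₁ (trans (cong (X₁ ─_) C≡) (p─[p∪q]-v≡⁅v⁆ v∈X₁))
    ∣C∣≤∣X₂∣ : ∣ C ∣ ≤ ∣ X₂ ∣
    ∣C∣≤∣X₂∣ = no-shorter c₂ (trans (cong (X₂ ─_) (trans C≡ (cong (_- v) (∪-comm X₁ X₂)))) (p─[p∪q]-v≡⁅v⁆ v∈X₂))
    ∣X₁∣+∣X₂∣≡∣C∣+2 : ∣ X₁ ∣ + ∣ X₂ ∣ ≡ ∣ C ∣ + 2
    ∣X₁∣+∣X₂∣≡∣C∣+2 = begin
      ∣ X₁ ∣ + ∣ X₂ ∣                           ≡⟨ ∣p∣+∣q∣≡∣p⊕q∣+2∣p∩q∣ X₁ X₂ ⟩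
      ∣ X₁ ⊕ X₂ ∣ + (∣ X₁ ∩ X₂ ∣ + ∣ X₁ ∩ X₂ ∣) ≡⟨ cong₂ (λ Z i → ∣ Z ∣ + (i + i)) X₁⊕X₂≡C ∣X₁∩X₂∣≡1 ⟩
      ∣ C ∣ + 2                                 ∎
    ∣C∣≤2 : ∣ C ∣ ≤ 2
    ∣C∣≤2 = +-cancelˡ-≤ ∣ C ∣ ∣ C ∣ 2
      (≤-trans (+-mono-≤ ∣C∣≤∣X₁∣ ∣C∣≤∣X₂∣) (≤-reflexive ∣X₁∣+∣X₂∣≡∣C∣+2))

  module _ {C C' : Subset n} {e : Fin n} (c : IsCircuit M C) (c' : IsCircuit M C')
           (C'─C≡⁅e⁆ : C' ─ C ≡ ⁅ e ⁆) where

    private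
      e∈C' : e ∈ C'
      e∈C' = q─p≡⁅e⁆⇒e∈q C'─C≡⁅e⁆

      C'-e⊆C : x ∈ C' → x ≢ e → x ∈ C
      C'-e⊆C = q─p≡⁅e⁆⇒q-e⊆p C'─C≡⁅e⁆

    e∈C⊕C' : e ∈ C ⊕ C'
    e∈C⊕C' = x∈p⊕q⁺ (inj₂ (q─p≡⁅e⁆⇒e∉p C'─C≡⁅e⁆ , e∈C'))

    [C⊕C']-e⊆C : x ∈ C ⊕ C' → x ≢ e → x ∈ C
    [C⊕C']-e⊆C x∈C⊕C' x≢e with x∈p⊕q⁻ x∈C⊕C'
    ... | inj₁ (x∈C , _) = x∈C
    ... | inj₂ (_ , x∈C') = C'-e⊆C x∈C' x≢e

    ∣C'∣≡1+∣C∩C'∣ : ∣ C' ∣ ≡ suc ∣ C ∩ C' ∣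
    ∣C'∣≡1+∣C∩C'∣ = begin
      ∣ C' ∣                   ≡⟨ ∣p─q∣+∣p∩q∣≡∣p∣ C' C ⟨
      ∣ C' ─ C ∣ + ∣ C' ∩ C ∣  ≡⟨ cong₂ (λ Z W → ∣ Z ∣ + ∣ W ∣) C'─C≡⁅e⁆ (∩-comm C' C) ⟩
      ∣ ⁅ e ⁆ ∣ + ∣ C ∩ C' ∣   ≡⟨ cong (_+ ∣ C ∩ C' ∣) (∣⁅x⁆∣≡1 e) ⟩
      suc ∣ C ∩ C' ∣           ∎

    2≤∣C∩C'∣ : 2 ≤ ∣ C ∩ C' ∣
    2≤∣C∩C'∣ = ≤-pred (subst (3 ≤_) ∣C'∣≡1+∣C∩C'∣ (Simple⇒3≤∣C∣ simple c'))

    ∣C⊕C'∣<∣C∣ : ∣ C ⊕ C' ∣ < ∣ C ∣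
    ∣C⊕C'∣<∣C∣ = ≤-pred (≤-trans (≤-reflexive (+-comm 2 ∣ C ⊕ C' ∣))
      (≤-trans (+-monoʳ-≤ ∣ C ⊕ C' ∣ 2≤∣C∩C'∣) (≤-reflexive ∣C⊕C'∣+∣C∩C'∣≡1+∣C∣)))
      where
      ∣C⊕C'∣+∣C∩C'∣≡1+∣C∣ : ∣ C ⊕ C' ∣ + ∣ C ∩ C' ∣ ≡ suc ∣ C ∣
      ∣C⊕C'∣+∣C∩C'∣≡1+∣C∣ = +-cancelʳ-≡ ∣ C ∩ C' ∣ _ _ (begin
        ∣ C ⊕ C' ∣ + ∣ C ∩ C' ∣ + ∣ C ∩ C' ∣   ≡⟨ +-assoc ∣ C ⊕ C' ∣ _ _ ⟩
        ∣ C ⊕ C' ∣ + (∣ C ∩ C' ∣ + ∣ C ∩ C' ∣) ≡⟨ ∣p∣+∣q∣≡∣p⊕q∣+2∣p∩q∣ C C' ⟨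
        ∣ C ∣ + ∣ C' ∣                         ≡⟨ cong (∣ C ∣ +_) ∣C'∣≡1+∣C∩C'∣ ⟩
        ∣ C ∣ + suc ∣ C ∩ C' ∣                 ≡⟨ +-suc ∣ C ∣ _ ⟩
        suc ∣ C ∣ + ∣ C ∩ C' ∣                 ∎)

    C'⊈C⊕C' : ¬ C' ⊆ C ⊕ C'
    C'⊈C⊕C' C'⊆C⊕C' =
      let x , x∈C∩C' = ∣p∣>0⇒Nonempty (≤-trans (s≤s z≤n) 2≤∣C∩C'∣)
          x∈C , x∈C' = x∈p∩q⁻ C C' x∈C∩C'
      in x∈p∩q⇒x∉p⊕q x∈C x∈C' (C'⊆C⊕C' x∈C')

    C⊕C'-circuit : IsCircuit M (C ⊕ C')
    C⊕C'-circuit = record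
      { nonEmpty = e , e∈C⊕C'
      ; zeroSum  = ZeroSum-⊕ M (IsCircuit.zeroSum c) (IsCircuit.zeroSum c')
      ; minimal  = minimal
      }
      where
      minimal : Y ⊆ C ⊕ C' → Nonempty Y → ZeroSum M Y → Y ≡ C ⊕ C'
      minimal {Y} Y⊆C⊕C' neY zY with e ∈? Y
      ... | no e∉Y = contradiction (p⊆q⇒∣p∣≤∣q∣ C⊆C⊕C') (<⇒≱ ∣C⊕C'∣<∣C∣)
        where
        Y⊆C : Y ⊆ C
        Y⊆C x∈Y = [C⊕C']-e⊆C (Y⊆C⊕C' x∈Y) λ { refl → e∉Y x∈Y }
        C⊆C⊕C' : C ⊆ C ⊕ C'
        C⊆C⊕C' = subst (_⊆ C ⊕ C') (IsCircuit.minimal c Y⊆C neY zY) Y⊆C⊕C'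
      ... | yes e∈Y = begin
        Y               ≡⟨ ⊕-cancelʳ Y C' ⟨
        Y ⊕ C' ⊕ C'     ≡⟨ cong (_⊕ C') Y⊕C'≡C ⟩
        C ⊕ C'          ∎
        where
        Y⊕C'⊆C : Y ⊕ C' ⊆ C
        Y⊕C'⊆C x∈Y⊕C' with x∈p⊕q⁻ x∈Y⊕C'
        ... | inj₁ (x∈Y , x∉C') = [C⊕C']-e⊆C (Y⊆C⊕C' x∈Y) λ { refl → x∉C' e∈C' }
        ... | inj₂ (x∉Y , x∈C') = C'-e⊆C x∈C' λ { refl → x∉Y e∈Y }
        Y≢C' : Y ≢ C'
        Y≢C' refl = C'⊈C⊕C' Y⊆C⊕C'
        Y⊕C'≡C : Y ⊕ C' ≡ C
        Y⊕C'≡C = IsCircuit.minimal c Y⊕C'⊆C (≢⇒Nonempty[p⊕q] Y≢C') (ZeroSum-⊕ M zY (IsCircuit.zeroSum c'))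

  Chord⇒Join : {C : Subset n} → IsCircuit M C → Chord M C → Join (λ Y → IsCircuit M Y × ∣ Y ∣ < ∣ C ∣) C
  Chord⇒Join {C} c (C' , c' , ∣C'─C∣≡1 , ∣C'∣<∣C∣) with e , C'─C≡⁅e⁆ ← ∣p∣≡1⇒p≡⁅x⁆ ∣C'─C∣≡1 =
    join C' (C ⊕ C') e
      (c' , ∣C'∣<∣C∣)
      (C⊕C'-circuit c c' C'─C≡⁅e⁆ , ∣C⊕C'∣<∣C∣ c c' C'─C≡⁅e⁆)
      (λ C'≡C⊕C' → C'⊈C⊕C' c c' C'─C≡⁅e⁆ (subst (C' ⊆_) C'≡C⊕C' ⊆-refl))
      (q─p≡⁅e⁆⇒e∈q C'─C≡⁅e⁆)
      (e∈C⊕C' c c' C'─C≡⁅e⁆)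
      (q─p≡⁅e⁆⇒p≡[q∪p⊕q]-e C'─C≡⁅e⁆)

  circuits⊆⟨chordless⟩ : (C : Subset n) → T (circuits M C) → Closure (circuits M) (chordless M) C
  circuits⊆⟨chordless⟩ C t = go (On.wellFounded ∣_∣ <-wellFounded C) (circuit-sound M t)
    where
    go : {C : Subset n} → Acc (_<_ on ∣_∣) C → IsCircuit M C → Closure (circuits M) (chordless M) C
    go (acc smaller) c with circuit⇒chordless⊎Chord M (circuit-complete M c)
    ... | inj₁ ch    = 0 , ch
    ... | inj₂ chord = Closure-join (circuits M) (chordless M) (circuit-complete M c)
      (Join-map (λ (cY , ∣Y∣<∣C∣) → go (smaller ∣Y∣<∣C∣) cY) (Chord⇒Join c chord))

  chordless⊆generator : {G : Fam n} → IsGenerator (circuits M) G → chordless M ⊆ᶠ G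
  chordless⊆generator {G} (G⊆circuits , _ , circuits⊆⟨G⟩) C ch =
    Closure-unjoinable (circuits M) G G⊆circuits
      (chordless-unjoinable ch ∘ Join-map (circuit-sound M))
      (circuits⊆⟨G⟩ C (chordless⇒circuit M ch))

theorem16 : {m n : ℕ} (A : Matrix m n) → Simple A →
    IsGenerator (circuits A) (chordless A) ×
    ((G : Fam n) → IsGenerator (circuits A) G →
      card (chordless A) ≤ card G ×
      (card G ≡ card (chordless A) → (X : Subset n) → G X ≡ chordless A X))
theorem16 A simple =
  (chordless⊆circuits , Closure⊆F (circuits A) (chordless A) chordless⊆circuits , circuits⊆⟨chordless⟩ A simple) ,
  λ G generates → let chordless⊆G = chordless⊆generator A simple generates
                  in card-mono chordless⊆G , card≡⇒≗ chordless⊆G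
  where
  chordless⊆circuits : chordless A ⊆ᶠ circuits A
  chordless⊆circuits _ = chordless⇒circuit A
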